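{- Let $(P_n)_{n\ge0}$ be the Padovan sequence and, for $1\le b\le 4$ and $m\ge 0$, let $r_m^{(4,b)}=\sum_{k=0}^{m}P_{4k+b}$. Then for every $m\ge 3$, $$r_m^{(4,b)}=2r_{m-1}^{(4,b)}+3r_{m-2}^{(4,b)}+r_{m-3}^{(4,b)}+c_b,$$ where $c_1=2$, $c_2=4$, $c_3=3$, $c_4=6$.
   Context: The Padovan numbers are defined by $P_0=P_1=P_2=1$ and $P_{n+3}=P_{n+1}+P_n$ for $n\ge 0$. -}

module Defs where

open import Data.Nat using (ℕ; zero; suc; _+_; _*_)

P : ℕ → ℕ
P 0 = 1
P 1 = 1
P 2 = 1
P (suc (suc (suc n))) = P (suc n) + P n

r : ℕ → ℕ → ℕ
r zero b = P b
r (suc m) b = r m b + P (4 * suc m + b)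

c : ℕ → ℕ
c 1 = 2
c 2 = 4
c 3 = 3
c 4 = 6
c _ = 0

-- Modulo x³ − x − 1 one has x¹² ≡ 2x⁸ + 3x⁴ + 1, so every stride-4 subsequence
-- of the Padovan numbers satisfies u₃ = 2u₂ + 3u₁ + u₀.  Summing this recurrence,
-- the partial sums satisfy it up to an additive constant, which is read off at m = 3.
module Submission where

open import Defs
open import Data.Nat using (ℕ; _+_; _*_; _∸_; _≤_; suc; s≤s)
open import Relation.Binary.PropositionalEquality using (_≡_; refl; cong; cong₂; sym; trans)
open import Data.Nat.Tactic.RingSolver using (solve-∀)

combination-+ : ∀ a b c d e f →
  (2 * a + 3 * b + c) + (2 * d + 3 * e + f) ≡ 2 * (a + d) + 3 * (b + e) + (c + f)
combination-+ = solve-∀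

P-+12 : ∀ n → P (12 + n) ≡ 2 * P (8 + n) + 3 * P (4 + n) + P n
P-+12 0 = refl
P-+12 1 = refl
P-+12 2 = refl
P-+12 (suc (suc (suc n))) =
  trans (cong₂ _+_ (P-+12 (suc n)) (P-+12 n))
        (combination-+ (P (8 + suc n)) (P (4 + suc n)) (P (suc n)) (P (8 + n)) (P (4 + n)) (P n))

4*-+-shift : ∀ j k b → 4 * (j + k) + b ≡ 4 * j + (4 * k + b)
4*-+-shift = solve-∀

P-stride4 : ∀ k b →
  P (4 * (3 + k) + b) ≡ 2 * P (4 * (2 + k) + b) + 3 * P (4 * (1 + k) + b) + P (4 * k + b)
P-stride4 k b =
  trans (cong P (4*-+-shift 3 k b))
    (trans (P-+12 (4 * k + b))
      (cong₂ (λ x y → 2 * P x + 3 * P y + P (4 * k + b))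
             (sym (4*-+-shift 2 k b)) (sym (4*-+-shift 1 k b))))

combination-+-const : ∀ a b c d x y z →
  (2 * a + 3 * b + c + d) + (2 * x + 3 * y + z) ≡ 2 * (a + x) + 3 * (b + y) + (c + z) + d
combination-+-const = solve-∀

r-recurrence : ∀ b d → r 3 b ≡ 2 * r 2 b + 3 * r 1 b + r 0 b + d → ∀ k →
  r (3 + k) b ≡ 2 * r (2 + k) b + 3 * r (1 + k) b + r k b + d
r-recurrence b d base 0 = base
r-recurrence b d base (suc k) =
  trans (cong₂ _+_ (r-recurrence b d base k) (P-stride4 (suc k) b))
        (combination-+-const (r (2 + k) b) (r (1 + k) b) (r k b) d
                 (P (4 * (3 + k) + b)) (P (4 * (2 + k) + b)) (P (4 * (1 + k) + b)))

mainTheorem10 : (b m : ℕ) → 1 ≤ b → b ≤ 4 → 3 ≤ m →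
    r m b ≡ 2 * r (m ∸ 1) b + 3 * r (m ∸ 2) b + r (m ∸ 3) b + c b
mainTheorem10 1 (suc (suc (suc k))) _ _ (s≤s (s≤s (s≤s _))) = r-recurrence 1 (c 1) refl k
mainTheorem10 2 (suc (suc (suc k))) _ _ (s≤s (s≤s (s≤s _))) = r-recurrence 2 (c 2) refl k
mainTheorem10 3 (suc (suc (suc k))) _ _ (s≤s (s≤s (s≤s _))) = r-recurrence 3 (c 3) refl k
mainTheorem10 4 (suc (suc (suc k))) _ _ (s≤s (s≤s (s≤s _))) = r-recurrence 4 (c 4) refl k
mainTheorem10 (suc (suc (suc (suc (suc _))))) _ _ (s≤s (s≤s (s≤s (s≤s ())))) _
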